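{- Let $n\geqslant 4$ and $2\leqslant k\leqslant n-2$. Then $\langle r_n, r_{n-1}, r_k\rangle=\mathrm{Sym}_n$ if and only if one of the following holds: (i) $n$ and $k$ are both even; (ii) $n\equiv 3\pmod 4$; (iii) $n\equiv 1\pmod 4$ and $k\equiv 2$ or $3\pmod 4$.
   Context: $\mathrm{Sym}_n$ is the symmetric group on $\{1,\dots,n\}$. For $1< i\leqslant n$, the prefix reversal $r_i\in\mathrm{Sym}_n$ is the permutation with $r_i(j)=i+1-j$ for $1\leqslant j\leqslant i$ and $r_i(j)=j$ for $i<j\leqslant n$. -}

module Defs where

open import Data.Nat using (ℕ; zero; suc; _∸_; _<?_)
open import Data.Fin using (Fin; toℕ; fromℕ<)
open import Data.List using (List)
open import Data.List.Membership.Propositional using (_∈_)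
open import Function using (id; _∘_)
open import Relation.Nullary using (yes; no)
open import Relation.Binary.PropositionalEquality using (_≡_)

-- Points of {1,…,n} are modelled by Fin n with the 0-based shift
-- x ↦ x - 1.  The prefix reversal r_i (for 1 < i ≤ n) sends the
-- 1-based point j ≤ i to i + 1 - j; in 0-based terms j' = j - 1 with
-- j' < i goes to i - 1 - j' = i ∸ suc j'.  Points j' ≥ i are fixed.
-- (The inner test "< n" always succeeds when i ≤ n; it only serves to
-- produce the Fin bound without carrying a proof argument.)
prefixRev : {n : ℕ} → ℕ → Fin n → Fin n
prefixRev {n} i j with toℕ j <? i
... | no _ = j
... | yes _ with i ∸ suc (toℕ j) <? n
...   | yes p = fromℕ< p
...   | no _ = j

data Generated {n : ℕ} (S : List (Fin n → Fin n)) : (Fin n → Fin n) → Set where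
  gen  : ∀ {g} → g ∈ S → Generated S g
  unit : Generated S id
  comp : ∀ {f g} → Generated S f → Generated S g → Generated S (f ∘ g)
  inv  : ∀ {g h} → Generated S g →
         (∀ x → h (g x) ≡ x) → (∀ x → g (h x) ≡ x) → Generated S h

module Submission where

-- Number the points 0, …, n − 1, let ρ i reverse the first i of them and let C = ρ n ∘ ρ (n − 1) be
-- the n-cycle x ↦ x + 1.  Since ρ n ∘ ρ k ∘ Cᵏ = ρ (n − k), the group G = ⟨ρ n, ρ (n − 1), ρ k⟩
-- contains ρ k and ρ (n − k).
--
-- Unless n is even and k odd, one of k, n − k is an even number e.  Then
-- C ∘ ρ e ∘ C⁻¹ ∘ ρ e rotates the first e + 1 points by two; as e + 1 is odd, some power of it is
-- the (e + 1)-cycle Z, and the commutator of Z with C ∘ Z ∘ C⁻¹ is a 3-cycle on consecutive points.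
-- Conjugating by powers of C gives all of these, hence every cycle of odd length on an initial
-- segment.  An odd permutation now produces a transposition: C itself when n is even, and
-- otherwise a reversal ρ r with r ≡ 3 (mod 4) (namely ρ n, ρ k, or ρ (k + 1) = (k + 1)-cycle ∘ ρ k),
-- which 3-cycles and odd cycles reduce four points at a time to ρ 3, and ρ 3 to the transposition
-- (1 2).  Conjugating a transposition of adjacent points by powers of C gives all of them.
--
-- Necessity.  ρ i has sign (−1)^(i(i−1)/2), so for n ≡ 1 and k ≡ 0, 1 (mod 4) all generators are
-- even.  For n even and k odd each generator preserves the parity of every point or reverses the
-- parity of every point.  The transposition (0 1) has neither property.

open import Defs
open import Data.Empty using (⊥-elim)
open import Data.Fin using (Fin; toℕ; fromℕ<)
import Data.Fin as Fin
open import Data.Fin.Permutation using (Permutation; _⟨$⟩ʳ_; transpose)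
import Data.Fin.Permutation.Components as Components
import Data.Fin.Permutation.Transposition.List as Transpositions
open import Data.Fin.Properties using (toℕ<n; toℕ-injective; toℕ-fromℕ<; fromℕ<-toℕ)
open import Data.List using (List; []; _∷_)
open import Data.List.Membership.Propositional using (_∈_)
open import Data.List.Relation.Unary.Any using (here; there)
open import Data.Nat using (ℕ; zero; suc; _+_; _*_; _∸_; _≤_; _<_; _<?_; _≟_; z≤n; s≤s; z<s; NonZero; _%_; _/_; parity)
open import Data.Nat.Divisibility using (divides)
open import Data.Nat.DivMod using (m≡m%n+[m/n]*n; m∣n⇒o%n%m≡o%m; m<n⇒m%n≡m; [m+n]%n≡m%n; [m+kn]%n≡m%n; %-distribˡ-+; m%n%n≡m%n; m%n<n)
open import Data.Nat.Properties
open import Data.Parity.Base as ℙ using (Parity; 0ℙ; 1ℙ; _⁻¹)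
import Data.Parity.Properties as ℙₚ
open import Algebra.Properties.CommutativeSemigroup ℙₚ.+-commutativeSemigroup using (interchange; xy∙z≈xz∙y; xy∙z≈x∙zy)
open import Data.Product using (Σ; _×_; _,_)
open import Data.Sum using (_⊎_; inj₁; inj₂)
open import Function.Base using (id; _∘_)
open import Function.Bundles using (_⇔_; mk⇔)
open import Function.Definitions using (Injective)
open import Relation.Binary.Definitions using (tri<; tri≈; tri>)
open import Relation.Binary.PropositionalEquality
open import Relation.Nullary using (Dec; yes; no; ¬_; contradiction)

variable
  a b d i j m p x y : ℕ
  f g : ℕ → ℕ

-- Reversals, rotations and transpositions of ℕ

m∸suc<m : x < m → m ∸ suc x < m
m∸suc<m {x} {suc m} (s≤s x≤m) = s≤s (m∸n≤m m x)

opaque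
  reverse : ℕ → ℕ → ℕ
  reverse m x with x <? m
  ... | yes _ = m ∸ suc x
  ... | no  _ = x

  reverse-< : x < m → reverse m x ≡ m ∸ suc x
  reverse-< {x} {m} x<m with x <? m
  ... | yes _   = refl
  ... | no  x≮m = contradiction x<m x≮m

  reverse-≥ : m ≤ x → reverse m x ≡ x
  reverse-≥ {m} {x} m≤x with x <? m
  ... | yes x<m = contradiction m≤x (<⇒≱ x<m)
  ... | no  _   = refl

reverse-involutive : ∀ m x → reverse m (reverse m x) ≡ x
reverse-involutive m x with x <? m
... | no  x≮m = trans (cong (reverse m) (reverse-≥ (≮⇒≥ x≮m))) (reverse-≥ (≮⇒≥ x≮m))
... | yes x<m = trans (cong (reverse m) (reverse-< x<m)) (trans (reverse-< (m∸suc<m x<m)) (reflect x<m))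
  where
  reflect : ∀ {m x} → x < m → m ∸ suc (m ∸ suc x) ≡ x
  reflect {m = suc m} (s≤s x≤m) = m∸[m∸n]≡n x≤m

reverse-one : ∀ x → reverse 1 x ≡ x
reverse-one zero    = reverse-< z<s
reverse-one (suc x) = reverse-≥ (s≤s z≤n)

opaque
  rotate : (L : ℕ) .{{_ : NonZero L}} → ℕ → ℕ → ℕ
  rotate L d x with x <? L
  ... | yes _ = (d + x) % L
  ... | no  _ = x

  rotate-< : ∀ {L d x} .{{_ : NonZero L}} → x < L → rotate L d x ≡ (d + x) % L
  rotate-< {L} {d} {x} x<L with x <? L
  ... | yes _   = refl
  ... | no  x≮L = contradiction x<L x≮L

  rotate-≥ : ∀ {L d x} .{{_ : NonZero L}} → L ≤ x → rotate L d x ≡ x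
  rotate-≥ {L} {d} {x} L≤x with x <? L
  ... | yes x<L = contradiction L≤x (<⇒≱ x<L)
  ... | no  _   = refl

module _ {L : ℕ} .{{_ : NonZero L}} where

  rotate-+ : ∀ a b x → rotate L a (rotate L b x) ≡ rotate L (a + b) x
  rotate-+ a b x with x <? L
  ... | no  x≮L = trans (cong (rotate L a) (rotate-≥ (≮⇒≥ x≮L))) (trans (rotate-≥ (≮⇒≥ x≮L)) (sym (rotate-≥ (≮⇒≥ x≮L))))
  ... | yes x<L = begin
    rotate L a (rotate L b x)   ≡⟨ cong (rotate L a) (rotate-< x<L) ⟩
    rotate L a ((b + x) % L)    ≡⟨ rotate-< (m%n<n (b + x) L) ⟩
    (a + (b + x) % L) % L       ≡⟨ %-distribˡ-+ a ((b + x) % L) L ⟩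
    (a % L + (b + x) % L % L) % L ≡⟨ cong (λ z → (a % L + z) % L) (m%n%n≡m%n (b + x) L) ⟩
    (a % L + (b + x) % L) % L   ≡⟨ %-distribˡ-+ a (b + x) L ⟨
    (a + (b + x)) % L           ≡⟨ cong (_% L) (+-assoc a b x) ⟨
    (a + b + x) % L             ≡⟨ rotate-< x<L ⟨
    rotate L (a + b) x          ∎
    where open ≡-Reasoning

  rotate-periodic : ∀ j x → rotate L (j * L) x ≡ x
  rotate-periodic j x with x <? L
  ... | no  x≮L = rotate-≥ (≮⇒≥ x≮L)
  ... | yes x<L = begin
    rotate L (j * L) x  ≡⟨ rotate-< x<L ⟩
    (j * L + x) % L  ≡⟨ cong (_% L) (+-comm (j * L) x) ⟩
    (x + j * L) % L  ≡⟨ [m+kn]%n≡m%n x j L ⟩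
    x % L            ≡⟨ m<n⇒m%n≡m x<L ⟩
    x                ∎
    where open ≡-Reasoning

  rotate-inbounds : d + x < L → rotate L d x ≡ d + x
  rotate-inbounds {d} d+x<L = trans (rotate-< (≤-trans (s≤s (m≤n+m _ d)) d+x<L)) (m<n⇒m%n≡m d+x<L)

  rotate-overflow : x < L → d + x ≡ L + y → y < L → rotate L d x ≡ y
  rotate-overflow {x} {d} {y} x<L d+x≡L+y y<L = begin
    rotate L d x  ≡⟨ rotate-< x<L ⟩
    (d + x) % L   ≡⟨ cong (_% L) (trans d+x≡L+y (+-comm L y)) ⟩
    (y + L) % L   ≡⟨ [m+n]%n≡m%n y L ⟩
    y % L         ≡⟨ m<n⇒m%n≡m y<L ⟩
    y             ∎
    where open ≡-Reasoning

  rotate-full : ∀ x → rotate L L x ≡ x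
  rotate-full x = trans (cong (λ c → rotate L c x) (sym (+-identityʳ L))) (rotate-periodic 1 x)

  rotate-inverse : ∀ a b → a + b ≡ L → ∀ x → rotate L a (rotate L b x) ≡ x
  rotate-inverse a b a+b≡L x = trans (rotate-+ a b x) (trans (cong (λ c → rotate L c x) a+b≡L) (rotate-full x))

rotate-suc : suc x < suc m → rotate (suc m) 1 x ≡ suc x
rotate-suc {x} = rotate-inbounds {d = 1} {x = x}

rotate-last : ∀ m → rotate (suc m) 1 m ≡ 0
rotate-last m = rotate-overflow ≤-refl (sym (+-identityʳ (suc m))) z<s

rotate-back : x < m → rotate (suc m) m (suc x) ≡ x
rotate-back {x} {m} x<m = rotate-overflow (s≤s x<m) (+-suc m x) (≤-trans x<m (n≤1+n m))

rotate-back-zero : ∀ m → rotate (suc m) m 0 ≡ m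
rotate-back-zero m = trans (rotate-inbounds {d = m} {x = 0} (s≤s (≤-reflexive (+-identityʳ m)))) (+-identityʳ m)

rotate-bounded : ∀ {n L} .{{_ : NonZero L}} d → L ≤ n → x < n → rotate L d x < n
rotate-bounded {x} {n} {L} d L≤n x<n with x <? L
... | yes x<L = subst (_< n) (sym (rotate-< x<L)) (<-≤-trans (m%n<n (d + x) L) L≤n)
... | no  x≮L = subst (_< n) (sym (rotate-≥ (≮⇒≥ x≮L))) x<n

opaque
  swap : ℕ → ℕ → ℕ → ℕ
  swap a b x with x ≟ a
  ... | yes _ = b
  ... | no  _ with x ≟ b
  ...   | yes _ = a
  ...   | no  _ = x

  swap-≡ˡ : x ≡ a → swap a b x ≡ b
  swap-≡ˡ {x} {a} x≡a with x ≟ a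
  ... | yes _   = refl
  ... | no  x≢a = contradiction x≡a x≢a

  swap-≡ʳ : x ≡ b → swap a b x ≡ a
  swap-≡ʳ {x} {b} {a} x≡b with x ≟ a
  ... | yes x≡a = trans (sym x≡b) x≡a
  ... | no  _ with x ≟ b
  ...   | yes _   = refl
  ...   | no  x≢b = contradiction x≡b x≢b

  swap-other : x ≢ a → x ≢ b → swap a b x ≡ x
  swap-other {x} {a} {b} x≢a x≢b with x ≟ a
  ... | yes x≡a = contradiction x≡a x≢a
  ... | no  _ with x ≟ b
  ...   | yes x≡b = contradiction x≡b x≢b
  ...   | no  _   = refl

swap-left : ∀ a b → swap a b a ≡ b
swap-left a b = swap-≡ˡ {a} {a} refl

swap-right : ∀ a b → swap a b b ≡ a
swap-right a b = swap-≡ʳ {b} {b} refl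

swap-involutive : ∀ a b x → swap a b (swap a b x) ≡ x
swap-involutive a b x = cases (x ≟ a) (x ≟ b)
  where
  cases : Dec (x ≡ a) → Dec (x ≡ b) → swap a b (swap a b x) ≡ x
  cases (yes x≡a) _         = trans (swap-≡ʳ (swap-≡ˡ x≡a)) (sym x≡a)
  cases (no  _)   (yes x≡b) = trans (swap-≡ˡ (swap-≡ʳ x≡b)) (sym x≡b)
  cases (no  x≢a) (no  x≢b) = trans (cong (swap a b) (swap-other x≢a x≢b)) (swap-other x≢a x≢b)

swap-self : ∀ a x → swap a a x ≡ x
swap-self a x = cases (x ≟ a)
  where
  cases : Dec (x ≡ a) → swap a a x ≡ x
  cases (yes x≡a) = trans (swap-≡ˡ x≡a) (sym x≡a)
  cases (no  x≢a) = swap-other x≢a x≢a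

swap-comm : ∀ a b x → swap a b x ≡ swap b a x
swap-comm a b x = cases (x ≟ a) (x ≟ b)
  where
  cases : Dec (x ≡ a) → Dec (x ≡ b) → swap a b x ≡ swap b a x
  cases (yes x≡a) (yes x≡b) = trans (swap-≡ˡ x≡a) (trans (sym x≡b) (trans x≡a (sym (swap-≡ˡ x≡b))))
  cases (yes x≡a) (no  _)   = trans (swap-≡ˡ x≡a) (sym (swap-≡ʳ x≡a))
  cases (no  _)   (yes x≡b) = trans (swap-≡ʳ x≡b) (sym (swap-≡ˡ x≡b))
  cases (no  x≢a) (no  x≢b) = trans (swap-other x≢a x≢b) (sym (swap-other x≢b x≢a))

swap-conjugate : (σ σ⁻¹ : ℕ → ℕ) → (∀ x → σ⁻¹ (σ x) ≡ x) → (∀ x → σ (σ⁻¹ x) ≡ x) →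
                 ∀ a b x → σ (swap a b (σ⁻¹ x)) ≡ swap (σ a) (σ b) x
swap-conjugate σ σ⁻¹ left right a b x =
  trans (transport (σ⁻¹ x)) (cong (swap (σ a) (σ b)) (right x))
  where
  injective : ∀ {y z} → y ≢ z → σ y ≢ σ z
  injective y≢z σy≡σz = y≢z (trans (sym (left _)) (trans (cong σ⁻¹ σy≡σz) (left _)))
  transport : ∀ y → σ (swap a b y) ≡ swap (σ a) (σ b) (σ y)
  transport y = cases (y ≟ a) (y ≟ b)
    where
    cases : Dec (y ≡ a) → Dec (y ≡ b) → σ (swap a b y) ≡ swap (σ a) (σ b) (σ y)
    cases (yes y≡a) _         = trans (cong σ (swap-≡ˡ y≡a)) (sym (swap-≡ˡ (cong σ y≡a)))
    cases (no  _)   (yes y≡b) = trans (cong σ (swap-≡ʳ y≡b)) (sym (swap-≡ʳ (cong σ y≡b)))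
    cases (no  y≢a) (no  y≢b) = trans (cong σ (swap-other y≢a y≢b)) (sym (swap-other (injective y≢a) (injective y≢b)))

cycle3 : ℕ → ℕ → ℕ
cycle3 a = swap a (suc a) ∘ swap (suc a) (2 + a)

cycle3-first : ∀ a → cycle3 a a ≡ suc a
cycle3-first a = trans (cong (swap a (suc a)) (swap-other (<⇒≢ (n<1+n a)) (<⇒≢ (m<n⇒m<1+n (n<1+n a))))) (swap-left a (suc a))

cycle3-second : ∀ a → cycle3 a (suc a) ≡ 2 + a
cycle3-second a = trans (cong (swap a (suc a)) (swap-left (suc a) (2 + a))) (swap-other (>⇒≢ (m<n⇒m<1+n (n<1+n a))) (>⇒≢ (n<1+n (suc a))))

cycle3-third : ∀ a → cycle3 a (2 + a) ≡ a
cycle3-third a = trans (cong (swap a (suc a)) (swap-right (suc a) (2 + a))) (swap-right a (suc a))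

cycle3-other : x ≢ a → x ≢ suc a → x ≢ 2 + a → cycle3 a x ≡ x
cycle3-other x≢a x≢a+1 x≢a+2 = trans (cong (swap _ _) (swap-other x≢a+1 x≢a+2)) (swap-other x≢a x≢a+1)

data Offset (a : ℕ) : ℕ → Set where
  below : x < a → Offset a x
  at    : ∀ i → Offset a (i + a)

offset : ∀ a x → Offset a x
offset a x with x <? a
... | yes x<a = below x<a
... | no  x≮a = subst (Offset a) (m∸n+n≡m (≮⇒≥ x≮a)) (at (x ∸ a))

rotate-extend : ∀ m x → rotate (2 + m) 1 x ≡ rotate (suc m) 1 (swap m (suc m) x)
rotate-extend m x with offset m x
... | below x<m = begin
  rotate (2 + m) 1 x                     ≡⟨ rotate-suc (s≤s (m<n⇒m<1+n x<m)) ⟩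
  suc x                                  ≡⟨ rotate-suc (s≤s x<m) ⟨
  rotate (suc m) 1 x                     ≡⟨ cong (rotate (suc m) 1) (swap-other (<⇒≢ x<m) (<⇒≢ (m<n⇒m<1+n x<m))) ⟨
  rotate (suc m) 1 (swap m (suc m) x)    ∎
  where open ≡-Reasoning
... | at 0 = begin
  rotate (2 + m) 1 m                     ≡⟨ rotate-suc ≤-refl ⟩
  suc m                                  ≡⟨ rotate-≥ ≤-refl ⟨
  rotate (suc m) 1 (suc m)               ≡⟨ cong (rotate (suc m) 1) (swap-left m (suc m)) ⟨
  rotate (suc m) 1 (swap m (suc m) m)    ∎
  where open ≡-Reasoning
... | at 1 = begin
  rotate (2 + m) 1 (suc m)                   ≡⟨ rotate-last (suc m) ⟩
  0                                          ≡⟨ rotate-last m ⟨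
  rotate (suc m) 1 m                         ≡⟨ cong (rotate (suc m) 1) (swap-right m (suc m)) ⟨
  rotate (suc m) 1 (swap m (suc m) (suc m))  ∎
  where open ≡-Reasoning
... | at (suc (suc i)) = begin
  rotate (2 + m) 1 x′                    ≡⟨ rotate-≥ (s≤s (s≤s (m≤n+m m i))) ⟩
  x′                                     ≡⟨ rotate-≥ (s≤s (m≤n+m m (suc i))) ⟨
  rotate (suc m) 1 x′                    ≡⟨ cong (rotate (suc m) 1) (swap-other (>⇒≢ (s≤s (m≤n+m m (suc i)))) (>⇒≢ (s≤s (s≤s (m≤n+m m i))))) ⟨
  rotate (suc m) 1 (swap m (suc m) x′)   ∎
  where open ≡-Reasoning
        x′ = 2 + i + m

rotate-extend-cycle3 : ∀ r x → rotate (3 + r) 1 x ≡ rotate (suc r) 1 (cycle3 r x)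
rotate-extend-cycle3 r x = trans (rotate-extend (suc r) x) (rotate-extend r _)

swap-0-1≡rotate-2 : ∀ x → swap 0 1 x ≡ rotate 2 1 x
swap-0-1≡rotate-2 x = sym (trans (rotate-extend 0 x) (rotate-full (swap 0 1 x)))

reverse-suc : ∀ m x → reverse (suc m) x ≡ rotate (suc m) 1 (reverse m x)
reverse-suc m x with offset m x
... | below x<m = begin
  reverse (suc m) x               ≡⟨ reverse-< (m<n⇒m<1+n x<m) ⟩
  m ∸ x                           ≡⟨ +-∸-assoc 1 x<m ⟩
  suc (m ∸ suc x)                 ≡⟨ rotate-suc (s≤s (m∸suc<m x<m)) ⟨
  rotate (suc m) 1 (m ∸ suc x)    ≡⟨ cong (rotate (suc m) 1) (reverse-< x<m) ⟨
  rotate (suc m) 1 (reverse m x)  ∎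
  where open ≡-Reasoning
... | at 0 = begin
  reverse (suc m) m               ≡⟨ reverse-< {m} ≤-refl ⟩
  m ∸ m                           ≡⟨ n∸n≡0 m ⟩
  0                               ≡⟨ rotate-last m ⟨
  rotate (suc m) 1 m              ≡⟨ cong (rotate (suc m) 1) (reverse-≥ {m} ≤-refl) ⟨
  rotate (suc m) 1 (reverse m m)  ∎
  where open ≡-Reasoning
... | at (suc i) = begin
  reverse (suc m) x′               ≡⟨ reverse-≥ (s≤s (m≤n+m m i)) ⟩
  x′                               ≡⟨ rotate-≥ (s≤s (m≤n+m m i)) ⟨
  rotate (suc m) 1 x′              ≡⟨ cong (rotate (suc m) 1) (reverse-≥ (m≤n+m m (suc i))) ⟨
  rotate (suc m) 1 (reverse m x′)  ∎
  where open ≡-Reasoning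
        x′ = suc i + m

reverse-peel : ∀ r x → reverse (3 + r) (rotate (3 + r) 2 x) ≡ swap (suc r) (2 + r) (reverse (suc r) x)
reverse-peel r x with offset (suc r) x
... | below x<r = begin
  reverse (3 + r) (rotate (3 + r) 2 x)  ≡⟨ cong (reverse (3 + r)) (rotate-inbounds {d = 2} (s≤s (s≤s x<r))) ⟩
  reverse (3 + r) (2 + x)               ≡⟨ reverse-< (s≤s (s≤s x<r)) ⟩
  r ∸ x                                 ≡⟨ swap-other (<⇒≢ (s≤s (m∸n≤m r x))) (<⇒≢ (m<n⇒m<1+n (s≤s (m∸n≤m r x)))) ⟨
  swap (suc r) (2 + r) (r ∸ x)          ≡⟨ cong (swap (suc r) (2 + r)) (reverse-< x<r) ⟨
  swap (suc r) (2 + r) (reverse (suc r) x) ∎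
  where open ≡-Reasoning
... | at 0 = begin
  reverse (3 + r) (rotate (3 + r) 2 (suc r))  ≡⟨ cong (reverse (3 + r)) (rotate-overflow {x = suc r} {d = 2} (s≤s (n≤1+n (suc r))) (sym (+-identityʳ (3 + r))) z<s) ⟩
  reverse (3 + r) 0                           ≡⟨ reverse-< z<s ⟩
  2 + r                                       ≡⟨ swap-left (suc r) (2 + r) ⟨
  swap (suc r) (2 + r) (suc r)                ≡⟨ cong (swap (suc r) (2 + r)) (reverse-≥ {suc r} ≤-refl) ⟨
  swap (suc r) (2 + r) (reverse (suc r) (suc r)) ∎
  where open ≡-Reasoning
... | at 1 = begin
  reverse (3 + r) (rotate (3 + r) 2 (2 + r))  ≡⟨ cong (reverse (3 + r)) (rotate-overflow {x = 2 + r} {d = 2} ≤-refl (+-comm 1 (3 + r)) (s≤s (s≤s z≤n))) ⟩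
  reverse (3 + r) 1                           ≡⟨ reverse-< (s≤s z<s) ⟩
  suc r                                       ≡⟨ swap-right (suc r) (2 + r) ⟨
  swap (suc r) (2 + r) (2 + r)                ≡⟨ cong (swap (suc r) (2 + r)) (reverse-≥ (n≤1+n (suc r))) ⟨
  swap (suc r) (2 + r) (reverse (suc r) (2 + r)) ∎
  where open ≡-Reasoning
... | at (suc (suc i)) = begin
  reverse (3 + r) (rotate (3 + r) 2 x′)  ≡⟨ cong (reverse (3 + r)) (rotate-≥ 3+r≤x′) ⟩
  reverse (3 + r) x′                     ≡⟨ reverse-≥ 3+r≤x′ ⟩
  x′                                     ≡⟨ swap-other (>⇒≢ (≤-trans (n≤1+n _) 3+r≤x′)) (>⇒≢ 3+r≤x′) ⟨
  swap (suc r) (2 + r) x′                ≡⟨ cong (swap (suc r) (2 + r)) (reverse-≥ (≤-trans (≤-trans (n≤1+n _) (n≤1+n _)) 3+r≤x′)) ⟨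
  swap (suc r) (2 + r) (reverse (suc r) x′) ∎
  where open ≡-Reasoning
        x′ = 2 + i + suc r
        3+r≤x′ : 3 + r ≤ x′
        3+r≤x′ = s≤s (s≤s (m≤n+m (suc r) i))

reverse-peel₄ : ∀ r x → reverse (suc r) x ≡
  cycle3 (suc r) (cycle3 (2 + r) (reverse (5 + r) (rotate (5 + r) 2 (rotate (3 + r) 2 x))))
reverse-peel₄ r x = begin
  ρ x                                                   ≡⟨ swap-involutive (suc r) (2 + r) (ρ x) ⟨
  s₁ (s₁ (ρ x))                                         ≡⟨ cong s₁ (swap-involutive (2 + r) (3 + r) _) ⟨
  s₁ (s₂ (s₂ (s₁ (ρ x))))                               ≡⟨ cong (s₁ ∘ s₂ ∘ s₂) (swap-involutive (3 + r) (4 + r) _) ⟨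
  s₁ (s₂ (s₂ (s₃ (s₃ (s₁ (ρ x))))))                     ≡⟨ cong (s₁ ∘ s₂ ∘ s₂ ∘ s₃ ∘ s₃) (reverse-peel r x) ⟨
  s₁ (s₂ (s₂ (s₃ (s₃ (reverse (3 + r) (rotate (3 + r) 2 x))))))
    ≡⟨ cong (s₁ ∘ s₂ ∘ s₂ ∘ s₃) (reverse-peel (2 + r) (rotate (3 + r) 2 x)) ⟨
  cycle3 (suc r) (cycle3 (2 + r) (reverse (5 + r) (rotate (5 + r) 2 (rotate (3 + r) 2 x)))) ∎
  where
  open ≡-Reasoning
  ρ = reverse (suc r)
  s₁ = swap (suc r) (2 + r)
  s₂ = swap (2 + r) (3 + r)
  s₃ = swap (3 + r) (4 + r)

complement-arithmetic : ∀ {i k N} → i < k → k ≤ N → N ∸ suc (k ∸ suc i) ≡ i + (N ∸ k)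
complement-arithmetic {i} i<k k≤N with m≤n⇒∃[o]m+o≡n i<k | m≤n⇒∃[o]m+o≡n k≤N
... | w , refl | v , refl = begin
  suc i + w + v ∸ suc (suc i + w ∸ suc i)  ≡⟨ cong (λ u → suc i + w + v ∸ suc u) (m+n∸m≡n (suc i) w) ⟩
  i + w + v ∸ w                            ≡⟨ cong (_∸ w) (trans (+-assoc i w v) (trans (cong (i +_) (+-comm w v)) (sym (+-assoc i v w)))) ⟩
  i + v + w ∸ w                            ≡⟨ m+n∸n≡m (i + v) w ⟩
  i + v                                    ≡⟨ cong (i +_) (m+n∸m≡n (suc i + w) v) ⟨
  i + (suc i + w + v ∸ (suc i + w))        ∎
  where open ≡-Reasoning

reverse-complement : ∀ N .{{_ : NonZero N}} k x → k ≤ N → x < N →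
                     reverse N (reverse k (rotate N k x)) ≡ reverse (N ∸ k) x
reverse-complement N k x k≤N x<N with offset (N ∸ k) x
... | below x<N∸k = begin
  reverse N (reverse k (rotate N k x))  ≡⟨ cong (reverse N ∘ reverse k) (rotate-inbounds k+x<N) ⟩
  reverse N (reverse k (k + x))         ≡⟨ cong (reverse N) (reverse-≥ (m≤m+n k x)) ⟩
  reverse N (k + x)                     ≡⟨ reverse-< k+x<N ⟩
  N ∸ suc (k + x)                       ≡⟨ cong (N ∸_) (+-suc k x) ⟨
  N ∸ (k + suc x)                       ≡⟨ ∸-+-assoc N k (suc x) ⟨
  N ∸ k ∸ suc x                         ≡⟨ reverse-< x<N∸k ⟨
  reverse (N ∸ k) x                     ∎
  where
  open ≡-Reasoning
  k+x<N : k + x < N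
  k+x<N = subst (_≤ N) (cong suc (+-comm x k)) (m≤o∸n⇒m+n≤o (suc x) k≤N x<N∸k)
... | at i = begin
  reverse N (reverse k (rotate N k x′))  ≡⟨ cong (reverse N ∘ reverse k) (rotate-overflow x<N wrap (<-≤-trans i<k k≤N)) ⟩
  reverse N (reverse k i)                ≡⟨ cong (reverse N) (reverse-< i<k) ⟩
  reverse N (k ∸ suc i)                  ≡⟨ reverse-< (<-≤-trans (m∸suc<m i<k) k≤N) ⟩
  N ∸ suc (k ∸ suc i)                    ≡⟨ complement-arithmetic i<k k≤N ⟩
  x′                                     ≡⟨ reverse-≥ (m≤n+m (N ∸ k) i) ⟨
  reverse (N ∸ k) x′                     ∎
  where
  open ≡-Reasoning
  x′ = i + (N ∸ k)
  N≡ : k + (N ∸ k) ≡ N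
  N≡ = m+[n∸m]≡n k≤N
  wrap : k + x′ ≡ N + i
  wrap = trans (sym (+-assoc k i (N ∸ k))) (trans (cong (_+ (N ∸ k)) (+-comm k i)) (trans (+-assoc i k (N ∸ k)) (trans (cong (i +_) N≡) (+-comm i N))))
  i<k : i < k
  i<k = +-cancelʳ-< (N ∸ k) i k (subst (x′ <_) (sym N≡) x<N)

transpose-toℕ : ∀ {n} (i j x : Fin n) → toℕ (Components.transpose i j x) ≡ swap (toℕ i) (toℕ j) (toℕ x)
transpose-toℕ i j x with x Data.Fin.≟ i
... | yes x≡i = sym (swap-≡ˡ (cong toℕ x≡i))
... | no  x≢i with x Data.Fin.≟ j
...   | yes x≡j = sym (swap-≡ʳ (cong toℕ x≡j))
...   | no  x≢j = sym (swap-other (x≢i ∘ toℕ-injective) (x≢j ∘ toℕ-injective))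

prefixRev-toℕ : ∀ {N} i → i ≤ N → (j : Fin N) → toℕ (prefixRev {N} i j) ≡ reverse i (toℕ j)
prefixRev-toℕ {N} i i≤N j with toℕ j <? i
... | no  j≮i = sym (reverse-≥ (≮⇒≥ j≮i))
... | yes j<i with i ∸ suc (toℕ j) <? N
...   | yes p   = trans (toℕ-fromℕ< p) (sym (reverse-< j<i))
...   | no  p≮N = contradiction (<-≤-trans (m∸suc<m j<i) i≤N) p≮N

-- Functions on ℕ realising elements of a generated subgroup

module Realisation {n : ℕ} (S : List (Fin n → Fin n)) where

  record Realised (f : ℕ → ℕ) : Set where
    constructor realised
    field
      {element} : Fin n → Fin n
      generated : Generated S element
      agrees    : ∀ x → toℕ (element x) ≡ f (toℕ x)

  realised-id : Realised id
  realised-id = realised unit (λ _ → refl)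

  realised-∘ : Realised f → Realised g → Realised (f ∘ g)
  realised-∘ {f} (realised Gf f-agrees) (realised {g′} Gg g-agrees) =
    realised (comp Gf Gg) λ x → trans (f-agrees (g′ x)) (cong f (g-agrees x))

  realised-cong : Realised f → (∀ x → x < n → f x ≡ g x) → Realised g
  realised-cong (realised G agrees) f≈g = realised G λ x → trans (agrees x) (f≈g (toℕ x) (toℕ<n x))

  Contains : (Fin n → Fin n) → Set
  Contains φ = Σ (Fin n → Fin n) λ g → Generated S g × (∀ x → g x ≡ φ x)

  AllPermutations : Set
  AllPermutations = (π : Permutation n n) → Contains (π ⟨$⟩ʳ_)

  transpositions⇒all : (∀ i j → i < n → j < n → Realised (swap i j)) → AllPermutations
  transpositions⇒all swaps π with evaluate (Transpositions.decompose π)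
    where
    transposition : ∀ i j → Contains (Components.transpose i j)
    transposition i j with swaps (toℕ i) (toℕ j) (toℕ<n i) (toℕ<n j)
    ... | realised G agrees = _ , G , λ x → toℕ-injective (trans (agrees x) (sym (transpose-toℕ i j x)))
    evaluate : ∀ τs → Contains (Transpositions.eval τs ⟨$⟩ʳ_)
    evaluate []             = id , unit , λ _ → refl
    evaluate ((i , j) ∷ τs) with evaluate τs | transposition i j
    ... | g , G , g≈ | h , H , h≈ = g ∘ h , comp G H , λ x → trans (cong g (h≈ x)) (g≈ _)
  ... | g , G , g≈ = g , G , λ x → trans (g≈ x) (Transpositions.eval-decompose π x)

  adjacent⇒swap : (∀ a → suc a < n → Realised (swap a (suc a))) → i < j → j < n → Realised (swap i j)
  adjacent⇒swap {i} {suc j} adjacent (s≤s i≤j) j<n with m≤n⇒m<n∨m≡n i≤j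
  ... | inj₂ refl = adjacent i j<n
  ... | inj₁ i<j  = realised-cong (realised-∘ (realised-∘ (adjacent j j<n) smaller) (adjacent j j<n)) conjugate
    where
    smaller = adjacent⇒swap adjacent i<j (<-trans (n<1+n j) j<n)
    conjugate : ∀ x → x < n → swap j (suc j) (swap i j (swap j (suc j) x)) ≡ swap i (suc j) x
    conjugate x _ = begin
      swap j (suc j) (swap i j (swap j (suc j) x))
        ≡⟨ swap-conjugate (swap j (suc j)) (swap j (suc j)) (swap-involutive j (suc j)) (swap-involutive j (suc j)) i j x ⟩
      swap (swap j (suc j) i) (swap j (suc j) j) x
        ≡⟨ cong₂ (λ u v → swap u v x) (swap-other (<⇒≢ i<j) (<⇒≢ (<-trans i<j (n<1+n j)))) (swap-left j (suc j)) ⟩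
      swap i (suc j) x ∎
      where open ≡-Reasoning

  adjacent⇒all : (∀ a → suc a < n → Realised (swap a (suc a))) → AllPermutations
  adjacent⇒all adjacent = transpositions⇒all swaps
    where
    swaps : ∀ i j → i < n → j < n → Realised (swap i j)
    swaps i j i<n j<n with <-cmp i j
    ... | tri< i<j _ _  = adjacent⇒swap adjacent i<j j<n
    ... | tri≈ _ refl _ = realised-cong realised-id (λ x _ → sym (swap-self i x))
    ... | tri> _ _ j<i  = realised-cong (adjacent⇒swap adjacent j<i i<n) (λ x _ → swap-comm j i x)

  realised-rotate-* : ∀ {L} .{{_ : NonZero L}} → Realised (rotate L d) → ∀ j → Realised (rotate L (j * d))
  realised-rotate-* R zero    = realised-cong realised-id (λ x _ → sym (rotate-periodic 0 x))
  realised-rotate-* {d} R (suc j) = realised-cong (realised-∘ R (realised-rotate-* R j)) (λ x _ → rotate-+ d (j * d) x)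

  realised-rotate⁻¹ : Realised (rotate (suc m) 1) → Realised (rotate (suc m) m)
  realised-rotate⁻¹ {m} Z = realised-cong (realised-rotate-* Z m) (λ x _ → cong (λ c → rotate (suc m) c x) (*-identityʳ m))

  even-rotation⇒swap : Realised (rotate (2 + m) 1) → Realised (rotate (suc m) 1) → Realised (swap m (suc m))
  even-rotation⇒swap {m} Z₊ Z = realised-cong (realised-∘ (realised-rotate⁻¹ Z) Z₊) λ x _ → begin
    rotate (suc m) m (rotate (2 + m) 1 x)                    ≡⟨ cong (rotate (suc m) m) (rotate-extend m x) ⟩
    rotate (suc m) m (rotate (suc m) 1 (swap m (suc m) x))   ≡⟨ rotate-inverse m 1 (+-comm m 1) _ ⟩
    swap m (suc m) x                                         ∎
    where open ≡-Reasoning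

  module _ (cycles : ∀ a → 2 + a < n → Realised (cycle3 a)) where

    odd-rotation : ∀ j → 1 + j * 2 ≤ n → Realised (rotate (1 + j * 2) 1)
    odd-rotation zero    _     = realised-cong realised-id (λ x _ → sym (rotate-full x))
    odd-rotation (suc j) bound = realised-cong (realised-∘ (odd-rotation j (≤-trans (n≤1+n _) (<⇒≤ bound))) (cycles (j * 2) bound))
                                              (λ x _ → sym (rotate-extend-cycle3 (j * 2) x))

    odd-rotation² : ∀ j → 1 + j * 2 ≤ n → Realised (rotate (1 + j * 2) 2)
    odd-rotation² j bound = realised-rotate-* (odd-rotation j bound) 2

    odd-reversal⇒swap : ∀ t → Realised (reverse (3 + t * 4)) → 3 + t * 4 ≤ n → Realised (swap 1 2)
    odd-reversal⇒swap zero    R bound = realised-cong (realised-∘ R (odd-rotation² 1 bound))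
                                                     (λ x _ → trans (reverse-peel 0 x) (cong (swap 1 2) (reverse-one x)))
    odd-reversal⇒swap (suc t) R bound = odd-reversal⇒swap t R′ (≤-trans (m≤n+m _ 4) bound)
      where
      t*4≡ : t * 2 * 2 ≡ t * 4
      t*4≡ = *-assoc t 2 2
      R₇ : Realised (rotate (7 + t * 4) 2)
      R₇ = subst (λ u → Realised (rotate (7 + u) 2)) t*4≡ (odd-rotation² (3 + t * 2) (subst (λ u → 7 + u ≤ n) (sym t*4≡) bound))
      R₅ : Realised (rotate (5 + t * 4) 2)
      R₅ = subst (λ u → Realised (rotate (5 + u) 2)) t*4≡
                 (odd-rotation² (2 + t * 2) (subst (λ u → 5 + u ≤ n) (sym t*4≡) (≤-trans (m≤n+m _ 2) bound)))
      R′ : Realised (reverse (3 + t * 4))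
      R′ = realised-cong (realised-∘ (realised-∘ (cycles (3 + t * 4) (≤-trans (n≤1+n _) bound)) (cycles (4 + t * 4) bound))
                                     (realised-∘ (realised-∘ R R₇) R₅))
                         (λ x _ → sym (reverse-peel₄ (2 + t * 4) x))

module Cyclic (m : ℕ) (S : List (Fin (suc m) → Fin (suc m))) (rotation : Realisation.Realised S (rotate (suc m) 1)) where
  open Realisation S

  private
    n = suc m
    C C⁻¹ : ℕ → ℕ
    C   = rotate n 1
    C⁻¹ = rotate n m

  C⁻¹∘C : ∀ x → C⁻¹ (C x) ≡ x
  C⁻¹∘C = rotate-inverse m 1 (+-comm m 1)

  C∘C⁻¹ : ∀ x → C (C⁻¹ x) ≡ x
  C∘C⁻¹ = rotate-inverse 1 m refl

  rotations : ∀ d → Realised (rotate n d)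
  rotations d = realised-cong (realised-rotate-* rotation d) (λ x _ → cong (λ c → rotate n c x) (*-identityʳ d))

  propagate : (F : ℕ → ℕ → ℕ) (w : ℕ) → (∀ a x → w + suc a < n → C (F a (C⁻¹ x)) ≡ F (suc a) x) →
              Realised (F a) → w + a < n → ∀ b → w + b < n → Realised (F b)
  propagate F w shift Fa w+a<n b w+b<n = fromFront b w+b<n (toFront _ Fa w+a<n)
    where
    smaller : ∀ a → w + suc a < n → w + a < n
    smaller a = <-trans (+-monoʳ-< w (n<1+n a))
    toFront : ∀ a → Realised (F a) → w + a < n → Realised (F 0)
    toFront zero    F0 _ = F0
    toFront (suc a) Fa bound = toFront a (realised-cong (realised-∘ (realised-∘ (rotations m) Fa) rotation) unshift) (smaller a bound)
      where
      unshift : ∀ x → x < n → C⁻¹ (F (suc a) (C x)) ≡ F a x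
      unshift x _ = begin
        C⁻¹ (F (suc a) (C x))         ≡⟨ cong C⁻¹ (shift a (C x) bound) ⟨
        C⁻¹ (C (F a (C⁻¹ (C x))))     ≡⟨ C⁻¹∘C _ ⟩
        F a (C⁻¹ (C x))               ≡⟨ cong (F a) (C⁻¹∘C x) ⟩
        F a x                         ∎
        where open ≡-Reasoning
    fromFront : ∀ b → w + b < n → Realised (F 0) → Realised (F b)
    fromFront zero    _     F0 = F0
    fromFront (suc b) bound F0 = realised-cong (realised-∘ (realised-∘ rotation (fromFront b (smaller b bound) F0)) (rotations m))
                                               (λ x _ → shift b x bound)

  swap-shift : ∀ a x → 1 + suc a < n → C (swap a (suc a) (C⁻¹ x)) ≡ swap (suc a) (2 + a) x
  swap-shift a x bound = begin
    C (swap a (suc a) (C⁻¹ x))   ≡⟨ swap-conjugate C C⁻¹ C⁻¹∘C C∘C⁻¹ a (suc a) x ⟩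
    swap (C a) (C (suc a)) x     ≡⟨ cong₂ (λ u v → swap u v x) (rotate-suc (<-trans (n<1+n _) bound)) (rotate-suc bound) ⟩
    swap (suc a) (2 + a) x       ∎
    where open ≡-Reasoning

  cycle3-shift : ∀ a x → 2 + suc a < n → C (cycle3 a (C⁻¹ x)) ≡ cycle3 (suc a) x
  cycle3-shift a x bound = begin
    C (swap a (suc a) (swap (suc a) (2 + a) (C⁻¹ x)))            ≡⟨ cong (C ∘ swap a (suc a)) (C⁻¹∘C (swap (suc a) (2 + a) (C⁻¹ x))) ⟨
    C (swap a (suc a) (C⁻¹ (C (swap (suc a) (2 + a) (C⁻¹ x)))))  ≡⟨ swap-shift a (C (swap (suc a) (2 + a) (C⁻¹ x))) (<-trans (n<1+n _) bound) ⟩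
    swap (suc a) (2 + a) (C (swap (suc a) (2 + a) (C⁻¹ x)))      ≡⟨ cong (swap (suc a) (2 + a)) (swap-shift (suc a) x bound) ⟩
    cycle3 (suc a) x                                              ∎
    where open ≡-Reasoning

  shifted-reverse∘reverse : ∀ e x → x < n → suc (suc e) < n → C (reverse (suc e) (C⁻¹ (reverse (suc e) x))) ≡ rotate (2 + e) 2 x
  shifted-reverse∘reverse e x x<n bound with offset e x
  ... | below x<e = begin
    C (reverse (suc e) (C⁻¹ (reverse (suc e) x)))   ≡⟨ cong (C ∘ reverse (suc e) ∘ C⁻¹) (trans (reverse-< (m<n⇒m<1+n x<e)) (+-∸-assoc 1 x<e)) ⟩
    C (reverse (suc e) (C⁻¹ (suc (e ∸ suc x))))     ≡⟨ cong (C ∘ reverse (suc e)) (rotate-back (≤-<-trans (m∸n≤m e (suc x)) (<-trans (n<1+n e) (≤-pred bound)))) ⟩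
    C (reverse (suc e) (e ∸ suc x))                 ≡⟨ cong C (reverse-< (m<n⇒m<1+n (m∸suc<m x<e))) ⟩
    C (e ∸ (e ∸ suc x))                             ≡⟨ cong C (m∸[m∸n]≡n x<e) ⟩
    C (suc x)                                       ≡⟨ rotate-suc (<-trans (s≤s (s≤s x<e)) bound) ⟩
    2 + x                                           ≡⟨ rotate-inbounds {d = 2} (s≤s (s≤s x<e)) ⟨
    rotate (2 + e) 2 x                              ∎
    where open ≡-Reasoning
  ... | at 0 = begin
    C (reverse (suc e) (C⁻¹ (reverse (suc e) e)))   ≡⟨ cong (C ∘ reverse (suc e) ∘ C⁻¹) (trans (reverse-< {e} ≤-refl) (n∸n≡0 e)) ⟩
    C (reverse (suc e) (C⁻¹ 0))                     ≡⟨ cong (C ∘ reverse (suc e)) (rotate-back-zero m) ⟩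
    C (reverse (suc e) m)                           ≡⟨ cong C (reverse-≥ {suc e} {m} (<⇒≤ (≤-pred bound))) ⟩
    C m                                             ≡⟨ rotate-last m ⟩
    0                                               ≡⟨ rotate-overflow {x = e} {d = 2} (m<n⇒m<1+n ≤-refl) (sym (+-identityʳ (2 + e))) z<s ⟨
    rotate (2 + e) 2 e                              ∎
    where open ≡-Reasoning
  ... | at 1 = begin
    C (reverse (suc e) (C⁻¹ (reverse (suc e) (suc e))))  ≡⟨ cong (C ∘ reverse (suc e) ∘ C⁻¹) (reverse-≥ {suc e} ≤-refl) ⟩
    C (reverse (suc e) (C⁻¹ (suc e)))                    ≡⟨ cong (C ∘ reverse (suc e)) (rotate-back {e} {m} (<-trans (n<1+n e) (≤-pred bound))) ⟩
    C (reverse (suc e) e)                                ≡⟨ cong C (trans (reverse-< {e} ≤-refl) (n∸n≡0 e)) ⟩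
    C 0                                                  ≡⟨ rotate-suc (≤-trans (s≤s (s≤s z≤n)) bound) ⟩
    1                                                    ≡⟨ rotate-overflow {x = suc e} {d = 2} ≤-refl (+-comm 1 (2 + e)) (s≤s (s≤s z≤n)) ⟨
    rotate (2 + e) 2 (suc e)                             ∎
    where open ≡-Reasoning
  ... | at (suc (suc i)) = begin
    C (reverse (suc e) (C⁻¹ (reverse (suc e) x′)))   ≡⟨ cong (C ∘ reverse (suc e) ∘ C⁻¹) (reverse-≥ (≤-trans (n≤1+n _) 2+e≤x′)) ⟩
    C (reverse (suc e) (C⁻¹ x′))                     ≡⟨ cong (C ∘ reverse (suc e)) (rotate-back (≤-pred x<n)) ⟩
    C (reverse (suc e) (suc (i + e)))                ≡⟨ cong C (reverse-≥ (s≤s (m≤n+m e i))) ⟩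
    C (suc (i + e))                                  ≡⟨ rotate-suc x<n ⟩
    x′                                               ≡⟨ rotate-≥ 2+e≤x′ ⟨
    rotate (2 + e) 2 x′                              ∎
    where open ≡-Reasoning
          x′ = 2 + i + e
          2+e≤x′ : 2 + e ≤ x′
          2+e≤x′ = s≤s (s≤s (m≤n+m e i))

  private
    Z Z⁻¹ : ℕ → ℕ → ℕ
    Z   p = rotate (2 + p) 1
    Z⁻¹ p = rotate (2 + p) (suc p)

  -- Z p cycles 0, …, 1 + p and C ∘ Z p ∘ C⁻¹ cycles 1, …, 2 + p, so (C ∘ Z p ∘ C⁻¹)⁻¹ ∘ Z p
  -- moves only three points.
  commutator-cycle3 : ∀ p x → x < n → 2 + p < n →
    Z⁻¹ p (C (Z⁻¹ p (C⁻¹ (Z p (Z p x))))) ≡ cycle3 p x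
  commutator-cycle3 p x x<n bound with offset p x
  ... | below x<p = begin
    Z⁻¹ p (C (Z⁻¹ p (C⁻¹ (Z p (Z p x)))))  ≡⟨ cong (Z⁻¹ p ∘ C ∘ Z⁻¹ p ∘ C⁻¹ ∘ Z p) (rotate-suc (s≤s (m<n⇒m<1+n x<p))) ⟩
    Z⁻¹ p (C (Z⁻¹ p (C⁻¹ (Z p (suc x)))))  ≡⟨ cong (Z⁻¹ p ∘ C ∘ Z⁻¹ p ∘ C⁻¹) (rotate-suc (s≤s (s≤s x<p))) ⟩
    Z⁻¹ p (C (Z⁻¹ p (C⁻¹ (2 + x))))      ≡⟨ cong (Z⁻¹ p ∘ C ∘ Z⁻¹ p) (rotate-back (<-trans (s≤s x<p) (≤-pred bound))) ⟩
    Z⁻¹ p (C (Z⁻¹ p (suc x)))            ≡⟨ cong (Z⁻¹ p ∘ C) (rotate-back (m<n⇒m<1+n x<p)) ⟩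
    Z⁻¹ p (C x)                        ≡⟨ cong (Z⁻¹ p) (rotate-suc (<-trans (s≤s (m<n⇒m<1+n x<p)) bound)) ⟩
    Z⁻¹ p (suc x)                      ≡⟨ rotate-back (m<n⇒m<1+n x<p) ⟩
    x                                ≡⟨ cycle3-other (<⇒≢ x<p) (<⇒≢ (m<n⇒m<1+n x<p)) (<⇒≢ (m<n⇒m<1+n (m<n⇒m<1+n x<p))) ⟨
    cycle3 p x                       ∎
    where open ≡-Reasoning
  ... | at 0 = begin
    Z⁻¹ p (C (Z⁻¹ p (C⁻¹ (Z p (Z p p)))))  ≡⟨ cong (Z⁻¹ p ∘ C ∘ Z⁻¹ p ∘ C⁻¹ ∘ Z p) (rotate-suc ≤-refl) ⟩
    Z⁻¹ p (C (Z⁻¹ p (C⁻¹ (Z p (suc p)))))  ≡⟨ cong (Z⁻¹ p ∘ C ∘ Z⁻¹ p ∘ C⁻¹) (rotate-last (suc p)) ⟩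
    Z⁻¹ p (C (Z⁻¹ p (C⁻¹ 0)))            ≡⟨ cong (Z⁻¹ p ∘ C ∘ Z⁻¹ p) (rotate-back-zero m) ⟩
    Z⁻¹ p (C (Z⁻¹ p m))                  ≡⟨ cong (Z⁻¹ p ∘ C) (rotate-≥ (≤-pred bound)) ⟩
    Z⁻¹ p (C m)                        ≡⟨ cong (Z⁻¹ p) (rotate-last m) ⟩
    Z⁻¹ p 0                            ≡⟨ rotate-back-zero (suc p) ⟩
    suc p                            ≡⟨ cycle3-first p ⟨
    cycle3 p p                       ∎
    where open ≡-Reasoning
  ... | at 1 = begin
    Z⁻¹ p (C (Z⁻¹ p (C⁻¹ (Z p (Z p (suc p))))))  ≡⟨ cong (Z⁻¹ p ∘ C ∘ Z⁻¹ p ∘ C⁻¹ ∘ Z p) (rotate-last (suc p)) ⟩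
    Z⁻¹ p (C (Z⁻¹ p (C⁻¹ (Z p 0))))            ≡⟨ cong (Z⁻¹ p ∘ C ∘ Z⁻¹ p ∘ C⁻¹) (rotate-suc (s≤s (s≤s z≤n))) ⟩
    Z⁻¹ p (C (Z⁻¹ p (C⁻¹ 1)))                ≡⟨ cong (Z⁻¹ p ∘ C ∘ Z⁻¹ p) (rotate-back (≤-<-trans z≤n (≤-pred bound))) ⟩
    Z⁻¹ p (C (Z⁻¹ p 0))                      ≡⟨ cong (Z⁻¹ p ∘ C) (rotate-back-zero (suc p)) ⟩
    Z⁻¹ p (C (suc p))                      ≡⟨ cong (Z⁻¹ p) (rotate-suc bound) ⟩
    Z⁻¹ p (2 + p)                          ≡⟨ rotate-≥ ≤-refl ⟩
    2 + p                                ≡⟨ cycle3-second p ⟨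
    cycle3 p (suc p)                     ∎
    where open ≡-Reasoning
  ... | at 2 = begin
    Z⁻¹ p (C (Z⁻¹ p (C⁻¹ (Z p (Z p (2 + p))))))  ≡⟨ cong (Z⁻¹ p ∘ C ∘ Z⁻¹ p ∘ C⁻¹) (trans (cong (Z p) (rotate-≥ ≤-refl)) (rotate-≥ ≤-refl)) ⟩
    Z⁻¹ p (C (Z⁻¹ p (C⁻¹ (2 + p))))          ≡⟨ cong (Z⁻¹ p ∘ C ∘ Z⁻¹ p) (rotate-back (≤-pred bound)) ⟩
    Z⁻¹ p (C (Z⁻¹ p (suc p)))                ≡⟨ cong (Z⁻¹ p ∘ C) (rotate-back ≤-refl) ⟩
    Z⁻¹ p (C p)                            ≡⟨ cong (Z⁻¹ p) (rotate-suc (<-trans (n<1+n _) bound)) ⟩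
    Z⁻¹ p (suc p)                          ≡⟨ rotate-back ≤-refl ⟩
    p                                    ≡⟨ cycle3-third p ⟨
    cycle3 p (2 + p)                     ∎
    where open ≡-Reasoning
  ... | at (suc (suc (suc i))) = begin
    Z⁻¹ p (C (Z⁻¹ p (C⁻¹ (Z p (Z p x′)))))  ≡⟨ cong (Z⁻¹ p ∘ C ∘ Z⁻¹ p ∘ C⁻¹) (trans (cong (Z p) (rotate-≥ 2+p≤x′)) (rotate-≥ 2+p≤x′)) ⟩
    Z⁻¹ p (C (Z⁻¹ p (C⁻¹ x′)))          ≡⟨ cong (Z⁻¹ p ∘ C ∘ Z⁻¹ p) (rotate-back (≤-pred x<n)) ⟩
    Z⁻¹ p (C (Z⁻¹ p (2 + i + p)))       ≡⟨ cong (Z⁻¹ p ∘ C) (rotate-≥ (s≤s (s≤s (m≤n+m p i)))) ⟩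
    Z⁻¹ p (C (2 + i + p))             ≡⟨ cong (Z⁻¹ p) (rotate-suc x<n) ⟩
    Z⁻¹ p x′                          ≡⟨ rotate-≥ 2+p≤x′ ⟩
    x′                              ≡⟨ cycle3-other (>⇒≢ (≤-trans (≤-trans (n≤1+n _) (n≤1+n _)) 3+p≤x′)) (>⇒≢ (≤-trans (n≤1+n _) 3+p≤x′)) (>⇒≢ 3+p≤x′) ⟨
    cycle3 p x′                     ∎
    where open ≡-Reasoning
          x′ = 3 + i + p
          3+p≤x′ : 3 + p ≤ x′
          3+p≤x′ = s≤s (s≤s (s≤s (m≤n+m p i)))
          2+p≤x′ : 2 + p ≤ x′
          2+p≤x′ = ≤-trans (n≤1+n _) 3+p≤x′

  even-reversal⇒cycle3 : ∀ q → Realised (reverse (2 + q * 2)) → 3 + q * 2 < n → ∀ a → 2 + a < n → Realised (cycle3 a)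
  even-reversal⇒cycle3 q R bound = propagate cycle3 2 cycle3-shift commutator bound
    where
    L = 3 + q * 2
    rotation2 : Realised (rotate L 2)
    rotation2 = realised-cong (realised-∘ (realised-∘ (realised-∘ rotation R) (rotations m)) R)
                              (λ x x<n → shifted-reverse∘reverse (suc (q * 2)) x x<n bound)
    -- (2 + q) * 2 = 1 + L, so this power of the rotation by 2 is the rotation by 1.
    Zᴸ : Realised (rotate L 1)
    Zᴸ = realised-cong (realised-rotate-* rotation2 (2 + q))
                      (λ x _ → trans (sym (rotate-+ 1 L x)) (cong (rotate L 1) (rotate-full x)))
    Zᴸ⁻¹ : Realised (rotate L (2 + q * 2))
    Zᴸ⁻¹ = realised-rotate⁻¹ Zᴸ
    commutator : Realised (cycle3 (suc (q * 2)))
    commutator = realised-cong (realised-∘ (realised-∘ (realised-∘ (realised-∘ (realised-∘ Zᴸ⁻¹ rotation) Zᴸ⁻¹) (rotations m)) Zᴸ) Zᴸ)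
                               (λ x x<n → commutator-cycle3 (suc (q * 2)) x x<n bound)

-- Residues and parities

%-split : ∀ x d {r} .{{_ : NonZero d}} → x % d ≡ r → x ≡ r + x / d * d
%-split x d x%d = trans (m≡m%n+[m/n]*n x d) (cong (_+ x / d * d) x%d)

%2-cases : ∀ x → x % 2 ≡ 0 ⊎ x % 2 ≡ 1
%2-cases x with x % 2 | m%n<n x 2
... | 0 | _ = inj₁ refl
... | 1 | _ = inj₂ refl
... | suc (suc _) | s≤s (s≤s ())

%4-cases : ∀ x → x % 4 ≡ 0 ⊎ x % 4 ≡ 1 ⊎ x % 4 ≡ 2 ⊎ x % 4 ≡ 3
%4-cases x with x % 4 | m%n<n x 4
... | 0 | _ = inj₁ refl
... | 1 | _ = inj₂ (inj₁ refl)
... | 2 | _ = inj₂ (inj₂ (inj₁ refl))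
... | 3 | _ = inj₂ (inj₂ (inj₂ refl))
... | suc (suc (suc (suc _))) | s≤s (s≤s (s≤s (s≤s ())))

mod4⇒mod2 : ∀ x → x % 4 ≡ i → x % 2 ≡ i % 2
mod4⇒mod2 x x%4 = trans (sym (m∣n⇒o%n%m≡o%m 2 4 x (divides 2 refl))) (cong (_% 2) x%4)

even-at-least-2 : x ≡ j * 2 → 2 ≤ x → Σ ℕ λ q → x ≡ 2 + q * 2
even-at-least-2 {j = zero}  refl ()
even-at-least-2 {j = suc q} x≡ _ = q , x≡

odd-difference : ∀ x y → x % 2 ≡ 1 → y % 2 ≡ 1 → x ∸ y ≡ (x / 2 ∸ y / 2) * 2
odd-difference x y x%2 y%2 = begin
  x ∸ y                          ≡⟨ cong₂ _∸_ (%-split x 2 x%2) (%-split y 2 y%2) ⟩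
  1 + x / 2 * 2 ∸ (1 + y / 2 * 2) ≡⟨ *-distribʳ-∸ 2 (x / 2) (y / 2) ⟨
  (x / 2 ∸ y / 2) * 2            ∎
  where open ≡-Reasoning

parity-suc : ∀ m → parity (suc m) ≡ parity m ⁻¹
parity-suc m = sym (ℙₚ.⁻¹-selfInverse (ℙₚ.suc-homo-⁻¹ m))

parity-%2 : ∀ x → parity x ≡ parity (x % 2)
parity-%2 x = begin
  parity x                                   ≡⟨ cong parity (m≡m%n+[m/n]*n x 2) ⟩
  parity (x % 2 + x / 2 * 2)                 ≡⟨ ℙₚ.+-homo-+ (x % 2) (x / 2 * 2) ⟩
  parity (x % 2) ℙ.+ parity (x / 2 * 2)      ≡⟨ cong (parity (x % 2) ℙ.+_) (trans (ℙₚ.*-homo-* (x / 2) 2) (ℙₚ.*-zeroʳ _)) ⟩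
  parity (x % 2) ℙ.+ 0ℙ                      ≡⟨ ℙₚ.+-identityʳ _ ⟩
  parity (x % 2)                             ∎
  where open ≡-Reasoning

parity-reverse : y < i → parity (reverse i y) ≡ parity i ⁻¹ ℙ.+ parity y
parity-reverse {y} {i} y<i = begin
  parity (reverse i y)                              ≡⟨ cong parity (reverse-< y<i) ⟩
  parity (i ∸ suc y)                                ≡⟨ rearrange (parity (i ∸ suc y)) (parity y) ⟩
  (parity (i ∸ suc y) ℙ.+ parity y ⁻¹) ⁻¹ ℙ.+ parity y  ≡⟨ cong (λ p → p ⁻¹ ℙ.+ parity y) split ⟨
  parity i ⁻¹ ℙ.+ parity y                          ∎
  where
  open ≡-Reasoning
  split : parity i ≡ parity (i ∸ suc y) ℙ.+ parity y ⁻¹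
  split = trans (cong parity (sym (m∸n+n≡m y<i))) (trans (ℙₚ.+-homo-+ (i ∸ suc y) (suc y)) (cong (parity (i ∸ suc y) ℙ.+_) (parity-suc y)))
  rearrange : ∀ a b → a ≡ (a ℙ.+ b ⁻¹) ⁻¹ ℙ.+ b
  rearrange 0ℙ 0ℙ = refl
  rearrange 0ℙ 1ℙ = refl
  rearrange 1ℙ 0ℙ = refl
  rearrange 1ℙ 1ℙ = refl

-- Inversion parity

add-twice : ∀ a b c → b ℙ.+ c ≡ (a ℙ.+ b) ℙ.+ (a ℙ.+ c)
add-twice a b c = sym (trans (interchange a b a c) (cong (ℙ._+ (b ℙ.+ c)) (ℙₚ.p+p≡0ℙ a)))

sum : ℕ → (ℕ → Parity) → Parity
sum zero    P = 0ℙ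
sum (suc m) P = sum m P ℙ.+ P m

module _ {P Q : ℕ → Parity} where

  sum-cong : ∀ m → (∀ i → i < m → P i ≡ Q i) → sum m P ≡ sum m Q
  sum-cong zero    _   = refl
  sum-cong (suc m) P≈Q = cong₂ ℙ._+_ (sum-cong m (λ i i<m → P≈Q i (m<n⇒m<1+n i<m))) (P≈Q m ≤-refl)

  sum-+ : ∀ m → sum m P ℙ.+ sum m Q ≡ sum m (λ i → P i ℙ.+ Q i)
  sum-+ zero    = refl
  sum-+ (suc m) = trans (interchange (sum m P) (P m) (sum m Q) (Q m)) (cong (ℙ._+ (P m ℙ.+ Q m)) (sum-+ m))

sum-shift : ∀ m P → sum (suc m) P ≡ P 0 ℙ.+ sum m (P ∘ suc)
sum-shift zero    P = ℙₚ.+-comm 0ℙ (P 0)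
sum-shift (suc m) P = trans (cong (ℙ._+ P (suc m)) (sum-shift m P)) (ℙₚ.+-assoc (P 0) _ _)

sum-ones : ∀ m → sum m (λ _ → 1ℙ) ≡ parity m
sum-ones zero    = refl
sum-ones (suc m) = begin
  sum m (λ _ → 1ℙ) ℙ.+ 1ℙ  ≡⟨ ℙₚ.+-comm _ 1ℙ ⟩
  sum m (λ _ → 1ℙ) ⁻¹      ≡⟨ cong _⁻¹ (sum-ones m) ⟩
  parity m ⁻¹              ≡⟨ parity-suc m ⟨
  parity (suc m)           ∎
  where open ≡-Reasoning

sum-rotate : ∀ P r j → suc r ≤ j → sum j (P ∘ rotate (suc r) 1) ≡ sum j P
sum-rotate P r (suc j) (s≤s r≤j) with m≤n⇒m<n∨m≡n r≤j
... | inj₁ r<j  = cong₂ ℙ._+_ (sum-rotate P r j r<j) (cong P (rotate-≥ r<j))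
... | inj₂ refl = begin
  sum r (P ∘ rotate (suc r) 1) ℙ.+ P (rotate (suc r) 1 r)  ≡⟨ cong₂ ℙ._+_ (sum-cong r (λ i i<r → cong P (rotate-suc (s≤s i<r)))) (cong P (rotate-last r)) ⟩
  sum r (P ∘ suc) ℙ.+ P 0                                 ≡⟨ ℙₚ.+-comm _ (P 0) ⟩
  P 0 ℙ.+ sum r (P ∘ suc)                                 ≡⟨ sum-shift r P ⟨
  sum (suc r) P                                           ∎
  where open ≡-Reasoning

less : ℕ → ℕ → Parity
less _       zero    = 0ℙ
less zero    (suc _) = 1ℙ
less (suc a) (suc b) = less a b

less-flip : ∀ a b → a ≢ b → less a b ℙ.+ less b a ≡ 1ℙ
less-flip zero    zero    a≢b = contradiction refl a≢b
less-flip zero    (suc b) _   = refl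
less-flip (suc a) zero    _   = refl
less-flip (suc a) (suc b) a≢b = less-flip a b (a≢b ∘ cong suc)

inversions : (ℕ → ℕ) → ℕ → Parity
inversions f m = sum m λ j → sum j λ i → less (f j) (f i)

inversions-cong : ∀ m → (∀ x → x < m → f x ≡ g x) → inversions f m ≡ inversions g m
inversions-cong m f≈g = sum-cong m λ j j<m →
  sum-cong j λ i i<j → cong₂ less (f≈g j j<m) (f≈g i (<-trans i<j j<m))

inversions-first : ∀ m f → inversions f (suc m) ≡ sum m (λ j → less (f (suc j)) (f 0)) ℙ.+ inversions (f ∘ suc) m
inversions-first zero    f = refl
inversions-first (suc m) f = begin
  inversions f (suc m) ℙ.+ sum (suc m) (λ i → less (f (suc m)) (f i))
    ≡⟨ cong₂ ℙ._+_ (inversions-first m f) (sum-shift m (λ i → less (f (suc m)) (f i))) ⟩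
  (X ℙ.+ I) ℙ.+ (less (f (suc m)) (f 0) ℙ.+ sum m (λ i → less (f (suc m)) (f (suc i))))
    ≡⟨ interchange X I _ _ ⟩
  (X ℙ.+ less (f (suc m)) (f 0)) ℙ.+ (I ℙ.+ sum m (λ i → less (f (suc m)) (f (suc i)))) ∎
  where
  open ≡-Reasoning
  X = sum m (λ j → less (f (suc j)) (f 0))
  I = inversions (f ∘ suc) m

InjectiveBelow : ℕ → (ℕ → ℕ) → Set
InjectiveBelow n h = ∀ {x y} → x < n → y < n → h x ≡ h y → x ≡ y

-- Rotating the first r + 1 points reverses the order of exactly the r pairs containing the first one.
inversions-rotate : ∀ {n h} → InjectiveBelow n h → ∀ r N → suc r ≤ N → N ≤ n →
                  inversions (h ∘ rotate (suc r) 1) N ≡ inversions h N ℙ.+ parity r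
inversions-rotate {n} {h} injective r (suc N) (s≤s r≤N) N<n with m≤n⇒m<n∨m≡n r≤N
... | inj₂ refl = begin
  inversions (h ∘ Z) r ℙ.+ sum r (λ i → less (h (Z r)) (h (Z i)))
    ≡⟨ cong₂ ℙ._+_ (inversions-cong r (λ x x<r → cong h (rotate-suc (s≤s x<r))))
                   (sum-cong r (λ i i<r → cong₂ less (cong h (rotate-last r)) (cong h (rotate-suc (s≤s i<r))))) ⟩
  I ℙ.+ sum r B                          ≡⟨ add-twice (sum r A) I (sum r B) ⟩
  (sum r A ℙ.+ I) ℙ.+ (sum r A ℙ.+ sum r B)  ≡⟨ cong₂ ℙ._+_ (sym (inversions-first r h)) (trans (sum-+ r) (trans (sum-cong r A+B≡1) (sum-ones r))) ⟩
  inversions h (suc r) ℙ.+ parity r      ∎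
  where
  open ≡-Reasoning
  Z = rotate (suc r) 1
  I = inversions (h ∘ suc) r
  A B : ℕ → Parity
  A j = less (h (suc j)) (h 0)
  B j = less (h 0) (h (suc j))
  A+B≡1 : ∀ i → i < r → A i ℙ.+ B i ≡ 1ℙ
  A+B≡1 i i<r = less-flip (h (suc i)) (h 0) λ eq → 1+n≢0 (injective (<-≤-trans (s≤s i<r) N<n) (≤-<-trans z≤n N<n) eq)
... | inj₁ r<N = begin
  inversions (h ∘ Z) N ℙ.+ sum N (λ i → less (h (Z N)) (h (Z i)))
    ≡⟨ cong₂ ℙ._+_ (inversions-rotate injective r N r<N (<⇒≤ N<n))
                   (trans (cong (λ y → sum N (λ i → less (h y) (h (Z i)))) (rotate-≥ r<N)) (sum-rotate (λ i → less (h N) (h i)) r N r<N)) ⟩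
  (inversions h N ℙ.+ parity r) ℙ.+ sum N (λ i → less (h N) (h i))  ≡⟨ xy∙z≈xz∙y (inversions h N) (parity r) _ ⟩
  inversions h (suc N) ℙ.+ parity r                                  ∎
  where
  open ≡-Reasoning
  Z = rotate (suc r) 1

-- The parity of m (m − 1) / 2, the number of inversions of reverse m.
triangular : ℕ → Parity
triangular m = sum m parity

inversions-reverse : ∀ {n h} → InjectiveBelow n h → ∀ m → m ≤ n → inversions (h ∘ reverse m) n ≡ inversions h n ℙ.+ triangular m
inversions-reverse {n} {h} _ zero _ = trans (inversions-cong n (λ x _ → cong h (reverse-≥ z≤n))) (sym (ℙₚ.+-identityʳ _))
inversions-reverse {n} {h} injective (suc m) m<n = begin
  inversions (h ∘ reverse (suc m)) n                ≡⟨ inversions-cong n (λ x _ → cong h (reverse-suc m x)) ⟩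
  inversions ((h ∘ Z) ∘ reverse m) n                ≡⟨ inversions-reverse injective′ m (<⇒≤ m<n) ⟩
  inversions (h ∘ Z) n ℙ.+ triangular m             ≡⟨ cong (ℙ._+ triangular m) (inversions-rotate injective m n m<n ≤-refl) ⟩
  (inversions h n ℙ.+ parity m) ℙ.+ triangular m    ≡⟨ xy∙z≈x∙zy (inversions h n) (parity m) (triangular m) ⟩
  inversions h n ℙ.+ triangular (suc m)             ∎
  where
  open ≡-Reasoning
  Z = rotate (suc m) 1
  injective′ : InjectiveBelow n (h ∘ Z)
  injective′ {x} {y} x<n y<n hZx≡hZy = begin
    x                        ≡⟨ rotate-inverse m 1 (+-comm m 1) x ⟨
    rotate (suc m) m (Z x)   ≡⟨ cong (rotate (suc m) m) (injective (rotate-bounded 1 m<n x<n) (rotate-bounded 1 m<n y<n) hZx≡hZy) ⟩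
    rotate (suc m) m (Z y)   ≡⟨ rotate-inverse m 1 (+-comm m 1) y ⟩
    y                        ∎

triangular-period : ∀ x → triangular (4 + x) ≡ triangular x
triangular-period x = begin
  (((T ℙ.+ u) ℙ.+ v) ℙ.+ u) ℙ.+ v   ≡⟨ cong (ℙ._+ v) (xy∙z≈xz∙y (T ℙ.+ u) v u) ⟩
  (((T ℙ.+ u) ℙ.+ u) ℙ.+ v) ℙ.+ v   ≡⟨ cong (λ z → (z ℙ.+ v) ℙ.+ v) (add-same T u) ⟩
  (T ℙ.+ v) ℙ.+ v                   ≡⟨ add-same T v ⟩
  T                                 ∎
  where
  open ≡-Reasoning
  T = triangular x
  u = parity x
  v = parity (suc x)
  add-same : ∀ a b → (a ℙ.+ b) ℙ.+ b ≡ a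
  add-same a b = trans (ℙₚ.+-assoc a b b) (trans (cong (a ℙ.+_) (ℙₚ.p+p≡0ℙ b)) (ℙₚ.+-identityʳ a))

triangular-4t : ∀ t → triangular (t * 4) ≡ 0ℙ
triangular-4t zero    = refl
triangular-4t (suc t) = trans (triangular-period (t * 4)) (triangular-4t t)

triangular-4t+1 : ∀ t → triangular (1 + t * 4) ≡ 0ℙ
triangular-4t+1 zero    = refl
triangular-4t+1 (suc t) = trans (triangular-period (1 + t * 4)) (triangular-4t+1 t)

opaque
  lift : ∀ {n} → (Fin n → Fin n) → ℕ → ℕ
  lift {n} g x with x <? n
  ... | yes x<n = toℕ (g (fromℕ< x<n))
  ... | no  _   = x

  lift-toℕ : ∀ {n} (g : Fin n → Fin n) y → lift g (toℕ y) ≡ toℕ (g y)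
  lift-toℕ {n} g y with toℕ y <? n
  ... | yes y<n = cong (toℕ ∘ g) (fromℕ<-toℕ y y<n)
  ... | no  y≮n = contradiction (toℕ<n y) y≮n

module _ {n : ℕ} where

  lift-< : ∀ (g : Fin n → Fin n) x (x<n : x < n) → lift g x ≡ toℕ (g (fromℕ< x<n))
  lift-< g x x<n = trans (cong (lift g) (sym (toℕ-fromℕ< x<n))) (lift-toℕ g _)

  lift-bounded : ∀ (g : Fin n → Fin n) x → x < n → lift g x < n
  lift-bounded g x x<n = subst (_< n) (sym (lift-< g x x<n)) (toℕ<n _)

  lift-∘ : ∀ (f g : Fin n → Fin n) x → x < n → lift (f ∘ g) x ≡ lift f (lift g x)
  lift-∘ f g x x<n = trans (lift-< (f ∘ g) x x<n) (sym (trans (cong (lift f) (lift-< g x x<n)) (lift-toℕ f _)))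

  lift-injective : ∀ {g : Fin n → Fin n} → Injective _≡_ _≡_ g → ∀ {h} → InjectiveBelow n h → InjectiveBelow n (h ∘ lift g)
  lift-injective {g} g-injective h-injective {x} {y} x<n y<n hgx≡hgy = begin
    x                       ≡⟨ toℕ-fromℕ< x<n ⟨
    toℕ (fromℕ< x<n)        ≡⟨ cong toℕ (g-injective (toℕ-injective gx≡gy)) ⟩
    toℕ (fromℕ< y<n)        ≡⟨ toℕ-fromℕ< y<n ⟩
    y                       ∎
    where
    open ≡-Reasoning
    gx≡gy : toℕ (g (fromℕ< x<n)) ≡ toℕ (g (fromℕ< y<n))
    gx≡gy = trans (sym (lift-< g x x<n)) (trans (h-injective (lift-bounded g x x<n) (lift-bounded g y y<n) hgx≡hgy) (lift-< g y y<n))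

module Invariants {n : ℕ} (S : List (Fin n → Fin n)) where

  generated-injective : (∀ {g} → g ∈ S → Injective _≡_ _≡_ g) → ∀ {g} → Generated S g → Injective _≡_ _≡_ g
  generated-injective S-injective (gen g∈)        = S-injective g∈
  generated-injective S-injective unit            = id
  generated-injective S-injective (comp Gf Gg)    = generated-injective S-injective Gg ∘ generated-injective S-injective Gf
  generated-injective S-injective (inv {g} {h} _ _ g∘h) {x} {y} hx≡hy = trans (sym (g∘h x)) (trans (cong g hx≡hy) (g∘h y))

  -- Quantifying over every injective h makes evenness closed under composition.
  Even : (Fin n → Fin n) → Set
  Even g = ∀ {h} → InjectiveBelow n h → inversions (h ∘ lift g) n ≡ inversions h n

  generated-even : (∀ {g} → g ∈ S → Injective _≡_ _≡_ g) → (∀ {g} → g ∈ S → Even g) → ∀ {g} → Generated S g → Even g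
  generated-even _ S-even (gen g∈) = S-even g∈
  generated-even _ _ unit {h} _ = inversions-cong n λ x x<n → cong h (trans (lift-< id x x<n) (toℕ-fromℕ< x<n))
  generated-even S-injective S-even (comp {f} {g} Gf Gg) {h} h-injective = begin
    inversions (h ∘ lift (f ∘ g)) n        ≡⟨ inversions-cong n (λ x x<n → cong h (lift-∘ f g x x<n)) ⟩
    inversions ((h ∘ lift f) ∘ lift g) n   ≡⟨ generated-even S-injective S-even Gg (lift-injective (generated-injective S-injective Gf) h-injective) ⟩
    inversions (h ∘ lift f) n              ≡⟨ generated-even S-injective S-even Gf h-injective ⟩
    inversions h n                         ∎
    where open ≡-Reasoning
  generated-even S-injective S-even (inv {g} {g⁻¹} Gg g⁻¹∘g g∘g⁻¹) {h} h-injective = begin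
    inversions (h ∘ lift g⁻¹) n              ≡⟨ generated-even S-injective S-even Gg (lift-injective g⁻¹-injective h-injective) ⟨
    inversions ((h ∘ lift g⁻¹) ∘ lift g) n   ≡⟨ inversions-cong n (λ x x<n → cong h (trans (sym (lift-∘ g⁻¹ g x x<n)) (trans (lift-< _ x x<n) (trans (cong toℕ (g⁻¹∘g _)) (toℕ-fromℕ< x<n))))) ⟩
    inversions h n                           ∎
    where
    open ≡-Reasoning
    g⁻¹-injective : Injective _≡_ _≡_ g⁻¹
    g⁻¹-injective {x} {y} eq = trans (sym (g∘g⁻¹ x)) (trans (cong g eq) (g∘g⁻¹ y))

  ShiftsParity : Parity → (Fin n → Fin n) → Set
  ShiftsParity p g = ∀ x → parity (toℕ (g x)) ≡ p ℙ.+ parity (toℕ x)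

  Uniform : (Fin n → Fin n) → Set
  Uniform g = Σ Parity λ p → ShiftsParity p g

  generated-uniform : (∀ {g} → g ∈ S → Uniform g) → ∀ {g} → Generated S g → Uniform g
  generated-uniform S-uniform (gen g∈) = S-uniform g∈
  generated-uniform S-uniform unit     = 0ℙ , λ _ → refl
  generated-uniform S-uniform (comp {f} {g} Gf Gg) with generated-uniform S-uniform Gf | generated-uniform S-uniform Gg
  ... | p , f-shifts | q , g-shifts = p ℙ.+ q , λ x → trans (f-shifts (g x)) (trans (cong (p ℙ.+_) (g-shifts x)) (sym (ℙₚ.+-assoc p q _)))
  generated-uniform S-uniform (inv {g} {g⁻¹} Gg _ g∘g⁻¹) with generated-uniform S-uniform Gg
  ... | p , g-shifts = p , λ x → shift-back (trans (sym (cong (parity ∘ toℕ) (g∘g⁻¹ x))) (g-shifts (g⁻¹ x)))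
    where
    shift-back : ∀ {a b} → a ≡ p ℙ.+ b → b ≡ p ℙ.+ a
    shift-back {a} {b} a≡p+b = begin
      b                     ≡⟨ cong (ℙ._+ b) (ℙₚ.p+p≡0ℙ p) ⟨
      (p ℙ.+ p) ℙ.+ b       ≡⟨ ℙₚ.+-assoc p p b ⟩
      p ℙ.+ (p ℙ.+ b)       ≡⟨ cong (p ℙ.+_) a≡p+b ⟨
      p ℙ.+ a               ∎
      where open ≡-Reasoning

-- The prefix reversals ρ n, ρ (n − 1) and ρ k

module PrefixReversals (n′ k : ℕ) (2≤k : 2 ≤ k) (k≤ : k ≤ 2 + n′) where

  n : ℕ
  n = 4 + n′

  generators : List (Fin n → Fin n)
  generators = prefixRev n ∷ prefixRev (n ∸ 1) ∷ prefixRev k ∷ []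

  open Realisation generators

  Condition : Set
  Condition = (n % 2 ≡ 0 × k % 2 ≡ 0) ⊎ (n % 4 ≡ 3) ⊎ (n % 4 ≡ 1 × (k % 4 ≡ 2 ⊎ k % 4 ≡ 3))

  k≤n : k ≤ n
  k≤n = ≤-trans k≤ (m≤n+m _ 2)

  reversal : ∀ {i} → prefixRev i ∈ generators → i ≤ n → Realised (reverse i)
  reversal {i} i∈ i≤n = realised (gen i∈) (prefixRev-toℕ i i≤n)

  rotation : Realised (rotate n 1)
  rotation = realised-cong (realised-∘ (reversal (here refl) ≤-refl) (reversal (there (here refl)) (n≤1+n _))) λ x _ → begin
    reverse n (reverse (3 + n′) x)                              ≡⟨ reverse-suc (3 + n′) _ ⟩
    rotate n 1 (reverse (3 + n′) (reverse (3 + n′) x))          ≡⟨ cong (rotate n 1) (reverse-involutive (3 + n′) x) ⟩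
    rotate n 1 x                                                ∎
    where open ≡-Reasoning

  open Cyclic (3 + n′) generators rotation

  complement-reversal : Realised (reverse (n ∸ k))
  complement-reversal = realised-cong (realised-∘ (realised-∘ (reversal (here refl) ≤-refl) (reversal (there (there (here refl))) k≤n)) (rotations k))
                             (λ x x<n → reverse-complement n k x k≤n x<n)

  cycles-from : ∀ e p → e ≡ p * 2 → Realised (reverse e) → 2 ≤ e → suc e < n → ∀ a → 2 + a < n → Realised (cycle3 a)
  cycles-from e p e≡ R 2≤e bound with even-at-least-2 {j = p} e≡ 2≤e
  ... | q , refl = even-reversal⇒cycle3 q R bound

  cycles-from-k : ∀ p → k ≡ p * 2 → ∀ a → 2 + a < n → Realised (cycle3 a)
  cycles-from-k p k≡ = cycles-from k p k≡ (reversal (there (there (here refl))) k≤n) 2≤k (s≤s (s≤s k≤))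

  cycles-from-complement : ∀ p → n ∸ k ≡ p * 2 → ∀ a → 2 + a < n → Realised (cycle3 a)
  cycles-from-complement p e≡ = cycles-from (n ∸ k) p e≡ complement-reversal (m+n≤o⇒m≤o∸n 2 (s≤s (s≤s k≤))) (s≤s (s≤s (∸-monoʳ-≤ n 2≤k)))

  from-adjacent : Realised (swap a (suc a)) → suc a < n → AllPermutations
  from-adjacent τ bound = adjacent⇒all (propagate (λ a → swap a (suc a)) 1 swap-shift τ bound)

  module _ (cycles : ∀ a → 2 + a < n → Realised (cycle3 a)) where

    from-odd-reversal : ∀ t → Realised (reverse (3 + t * 4)) → 3 + t * 4 ≤ n → AllPermutations
    from-odd-reversal t R bound = from-adjacent (odd-reversal⇒swap cycles t R bound) (s≤s (s≤s (s≤s z≤n)))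

    from-even-rotation : n % 2 ≡ 0 → AllPermutations
    from-even-rotation n%2 with n / 2 | %-split n 2 n%2
    ... | 0           | ()
    ... | 1           | ()
    ... | suc (suc q) | n≡ = from-adjacent (even-rotation⇒swap rotation (subst (λ u → Realised (rotate (3 + u) 1)) n′≡ odd)) ≤-refl
      where
      n′≡ : q * 2 ≡ n′
      n′≡ = sym (cong (_∸ 4) n≡)
      odd : Realised (rotate (3 + q * 2) 1)
      odd = odd-rotation cycles (suc q) (subst (λ u → 3 + u ≤ n) (sym n′≡) (n≤1+n _))

  sufficient : Condition → AllPermutations
  sufficient (inj₁ (n%2 , k%2)) = from-even-rotation (cycles-from-k (k / 2) (%-split k 2 k%2)) n%2
  sufficient (inj₂ (inj₁ n%4)) = from-odd-reversal cycles (n / 4) (subst (Realised ∘ reverse) n≡ (reversal (here refl) ≤-refl)) (subst (_≤ n) n≡ ≤-refl)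
    where
    n≡ = %-split n 4 n%4
    cycles : ∀ a → 2 + a < n → Realised (cycle3 a)
    cycles with %2-cases k
    ... | inj₁ k%2 = cycles-from-k (k / 2) (%-split k 2 k%2)
    ... | inj₂ k%2 = cycles-from-complement (n / 2 ∸ k / 2) (odd-difference n k (mod4⇒mod2 n n%4) k%2)
  sufficient (inj₂ (inj₂ (n%4 , inj₁ k%4))) = from-odd-reversal cycles t R bound
    where
    t = k / 4
    k≡ : k ≡ 2 + t * 4
    k≡ = %-split k 4 k%4
    t*4≡ : t * 2 * 2 ≡ t * 4
    t*4≡ = *-assoc t 2 2
    bound : 3 + t * 4 ≤ n
    bound = subst (λ u → suc u ≤ n) k≡ (<⇒≤ (s≤s (s≤s k≤)))
    cycles : ∀ a → 2 + a < n → Realised (cycle3 a)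
    cycles = cycles-from-k (suc (t * 2)) (trans k≡ (cong (2 +_) (sym t*4≡)))
    R : Realised (reverse (3 + t * 4))
    R = realised-cong (realised-∘ (subst (λ u → Realised (rotate (3 + u) 1)) t*4≡ (odd-rotation cycles (suc (t * 2)) (subst (λ u → 3 + u ≤ n) (sym t*4≡) bound)))
                                  (subst (Realised ∘ reverse) k≡ (reversal (there (there (here refl))) k≤n)))
                      (λ x _ → sym (reverse-suc (2 + t * 4) x))
  sufficient (inj₂ (inj₂ (n%4 , inj₂ k%4))) =
    from-odd-reversal (cycles-from-complement (n / 2 ∸ k / 2) (odd-difference n k (mod4⇒mod2 n n%4) (mod4⇒mod2 k k%4))) (k / 4)
                      (subst (Realised ∘ reverse) k≡ (reversal (there (there (here refl))) k≤n)) (subst (_≤ n) k≡ k≤n)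
    where
    k≡ = %-split k 4 k%4

  open Invariants generators

  lift-prefixRev : ∀ {i} → i ≤ n → ∀ x → x < n → lift (prefixRev i) x ≡ reverse i x
  lift-prefixRev {i} i≤n x x<n = trans (lift-< (prefixRev i) x x<n) (trans (prefixRev-toℕ i i≤n _) (cong (reverse i) (toℕ-fromℕ< x<n)))

  prefixRev-injective : ∀ {i} → i ≤ n → Injective _≡_ _≡_ (prefixRev {n} i)
  prefixRev-injective {i} i≤n {x} {y} eq = toℕ-injective (begin
    toℕ x                                     ≡⟨ reverse-involutive i (toℕ x) ⟨
    reverse i (reverse i (toℕ x))             ≡⟨ cong (reverse i) (prefixRev-toℕ i i≤n x) ⟨
    reverse i (toℕ (prefixRev i x))           ≡⟨ cong (reverse i ∘ toℕ) eq ⟩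
    reverse i (toℕ (prefixRev i y))           ≡⟨ cong (reverse i) (prefixRev-toℕ i i≤n y) ⟩
    reverse i (reverse i (toℕ y))             ≡⟨ reverse-involutive i (toℕ y) ⟩
    toℕ y                                     ∎)
    where open ≡-Reasoning

  generators-injective : ∀ {g} → g ∈ generators → Injective _≡_ _≡_ g
  generators-injective (here refl)                 = prefixRev-injective ≤-refl
  generators-injective (there (here refl))         = prefixRev-injective (n≤1+n _)
  generators-injective (there (there (here refl))) = prefixRev-injective k≤n

  transposition : AllPermutations →
                  Σ (Fin n → Fin n) λ g → Generated generators g × (∀ x → x < n → lift g x ≡ swap 0 1 x)
  transposition all with all (transpose Fin.zero (Fin.suc Fin.zero))
  ... | g , G , g≈ = g , G , λ x x<n → trans (lift-< g x x<n)
                                             (trans (cong toℕ (g≈ _)) (trans (transpose-toℕ _ _ _) (cong (swap 0 1) (toℕ-fromℕ< x<n))))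

  even-prefixRev : ∀ {i} → i ≤ n → triangular i ≡ 0ℙ → Even (prefixRev i)
  even-prefixRev {i} i≤n triangular≡0 {h} h-injective = begin
    inversions (h ∘ lift (prefixRev i)) n   ≡⟨ inversions-cong n (λ x x<n → cong h (lift-prefixRev i≤n x x<n)) ⟩
    inversions (h ∘ reverse i) n            ≡⟨ inversions-reverse h-injective i i≤n ⟩
    inversions h n ℙ.+ triangular i         ≡⟨ cong (inversions h n ℙ.+_) triangular≡0 ⟩
    inversions h n ℙ.+ 0ℙ                   ≡⟨ ℙₚ.+-identityʳ _ ⟩
    inversions h n                          ∎
    where open ≡-Reasoning

  sign-obstruction : n % 4 ≡ 1 → (k % 4 ≡ 0 ⊎ k % 4 ≡ 1) → ¬ AllPermutations
  sign-obstruction n%4 k%4 all with transposition all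
  ... | g , G , g≈swap = ℙₚ.p≢p⁻¹ (inversions id n) (begin
    inversions id n                    ≡⟨ generated-even generators-injective generators-even G {id} (λ _ _ eq → eq) ⟨
    inversions (lift g) n              ≡⟨ inversions-cong n (λ x x<n → trans (g≈swap x x<n) (swap-0-1≡rotate-2 x)) ⟩
    inversions (rotate 2 1) n          ≡⟨ inversions-rotate {h = id} (λ _ _ eq → eq) 1 n (s≤s (s≤s z≤n)) ≤-refl ⟩
    inversions id n ℙ.+ 1ℙ             ≡⟨ ℙₚ.+-comm _ 1ℙ ⟩
    inversions id n ⁻¹                 ∎)
    where
    open ≡-Reasoning
    t = n / 4
    n≡ : n ≡ 1 + t * 4
    n≡ = %-split n 4 n%4
    generators-even : ∀ {g} → g ∈ generators → Even g
    generators-even (here refl)                 = even-prefixRev ≤-refl (subst (λ m → triangular m ≡ 0ℙ) (sym n≡) (triangular-4t+1 t))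
    generators-even (there (here refl))         = even-prefixRev (n≤1+n _) (subst (λ m → triangular m ≡ 0ℙ) (sym (cong (_∸ 1) n≡)) (triangular-4t t))
    generators-even (there (there (here refl))) = even-prefixRev k≤n (k-triangular k%4)
      where
      k-triangular : k % 4 ≡ 0 ⊎ k % 4 ≡ 1 → triangular k ≡ 0ℙ
      k-triangular (inj₁ k%4≡0) = subst (λ m → triangular m ≡ 0ℙ) (sym (%-split k 4 k%4≡0)) (triangular-4t (k / 4))
      k-triangular (inj₂ k%4≡1) = subst (λ m → triangular m ≡ 0ℙ) (sym (%-split k 4 k%4≡1)) (triangular-4t+1 (k / 4))

  shifts-prefixRev-odd : ∀ {i} → i ≤ n → parity i ≡ 1ℙ → ShiftsParity 0ℙ (prefixRev i)
  shifts-prefixRev-odd {i} i≤n i-odd x = trans (cong parity (prefixRev-toℕ i i≤n x)) (cases (toℕ x <? i))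
    where
    cases : Dec (toℕ x < i) → parity (reverse i (toℕ x)) ≡ 0ℙ ℙ.+ parity (toℕ x)
    cases (yes x<i) = trans (parity-reverse x<i) (cong (λ p → p ⁻¹ ℙ.+ parity (toℕ x)) i-odd)
    cases (no  x≮i) = cong parity (reverse-≥ (≮⇒≥ x≮i))

  shifts-prefixRev-n : parity n ≡ 0ℙ → ShiftsParity 1ℙ (prefixRev n)
  shifts-prefixRev-n n-even x = trans (cong parity (prefixRev-toℕ n ≤-refl x)) (trans (parity-reverse (toℕ<n x)) (cong (λ p → p ⁻¹ ℙ.+ parity (toℕ x)) n-even))

  generators-uniform : parity n ≡ 0ℙ → parity k ≡ 1ℙ → ∀ {g} → g ∈ generators → Uniform g
  generators-uniform n-even k-odd (here refl)                 = 1ℙ , shifts-prefixRev-n n-even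
  generators-uniform n-even k-odd (there (here refl))         = 0ℙ , shifts-prefixRev-odd (n≤1+n _) (trans (parity-suc (2 + n′)) (cong _⁻¹ n-even))
  generators-uniform n-even k-odd (there (there (here refl))) = 0ℙ , shifts-prefixRev-odd k≤n k-odd

  block-obstruction : n % 2 ≡ 0 → k % 2 ≡ 1 → ¬ AllPermutations
  block-obstruction n%2 k%2 all with transposition all
  ... | g , G , g≈swap with generated-uniform (generators-uniform (trans (parity-%2 n) (cong parity n%2)) (trans (parity-%2 k) (cong parity k%2))) G
  ...   | p , g-shifts = 1ℙ≢0ℙ (begin
    1ℙ                               ≡⟨ cong parity (trans (sym (swap-left 0 1)) (trans (sym (g≈swap 0 z<s)) (lift-toℕ g Fin.zero))) ⟩
    parity (toℕ (g Fin.zero))        ≡⟨ g-shifts Fin.zero ⟩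
    p ℙ.+ 0ℙ                         ≡⟨ g-shifts (Fin.suc (Fin.suc Fin.zero)) ⟨
    parity (toℕ (g two))             ≡⟨ cong parity (trans (sym (lift-toℕ g two)) (trans (g≈swap 2 (s≤s (s≤s z<s))) (swap-other (λ ()) (λ ())))) ⟩
    0ℙ                               ∎)
    where
    open ≡-Reasoning
    two : Fin n
    two = Fin.suc (Fin.suc Fin.zero)
    1ℙ≢0ℙ : 1ℙ ≢ 0ℙ
    1ℙ≢0ℙ ()

  necessary-even : AllPermutations → n % 2 ≡ 0 → Condition
  necessary-even all n%2 with %2-cases k
  ... | inj₁ k%2 = inj₁ (n%2 , k%2)
  ... | inj₂ k%2 = ⊥-elim (block-obstruction n%2 k%2 all)

  necessary : AllPermutations → Condition
  necessary all with %4-cases n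
  ... | inj₁ n%4≡0                   = necessary-even all (mod4⇒mod2 n n%4≡0)
  ... | inj₂ (inj₂ (inj₁ n%4≡2))     = necessary-even all (mod4⇒mod2 n n%4≡2)
  ... | inj₂ (inj₂ (inj₂ n%4≡3))     = inj₂ (inj₁ n%4≡3)
  ... | inj₂ (inj₁ n%4≡1) with %4-cases k
  ...   | inj₁ k%4≡0               = ⊥-elim (sign-obstruction n%4≡1 (inj₁ k%4≡0) all)
  ...   | inj₂ (inj₁ k%4≡1)        = ⊥-elim (sign-obstruction n%4≡1 (inj₂ k%4≡1) all)
  ...   | inj₂ (inj₂ (inj₁ k%4≡2)) = inj₂ (inj₂ (n%4≡1 , inj₁ k%4≡2))
  ...   | inj₂ (inj₂ (inj₂ k%4≡3)) = inj₂ (inj₂ (n%4≡1 , inj₂ k%4≡3))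

mainTheorem5 : (n k : ℕ) → 4 ≤ n → 2 ≤ k → k ≤ n ∸ 2 →
    ((π : Permutation n n) →
        Σ (Fin n → Fin n) (λ g →
          Generated (prefixRev n ∷ prefixRev (n ∸ 1) ∷ prefixRev k ∷ []) g
          × ((x : Fin n) → g x ≡ π ⟨$⟩ʳ x)))
    ⇔ ((n % 2 ≡ 0 × k % 2 ≡ 0)
       ⊎ (n % 4 ≡ 3)
       ⊎ (n % 4 ≡ 1 × (k % 4 ≡ 2 ⊎ k % 4 ≡ 3)))
mainTheorem5 (suc (suc (suc (suc n′)))) k (s≤s (s≤s (s≤s (s≤s z≤n)))) 2≤k k≤n∸2 = mk⇔ necessary sufficient
  where open PrefixReversals n′ k 2≤k k≤n∸2
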